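{- For every finite simple graph $G$, the set system $(V(G),\Psi(G))$ is an augmentoid. That is, $\Psi(G)$ is nonempty, and for every $S,T\in\Psi(G)$ there exist sets $A\subseteq S\setminus T$ and $B\subseteq T\setminus S$ such that $T\cup A\in\Psi(G)$, $S\cup B\in\Psi(G)$, and $|T\cup A|=|S\cup B|$.
   Context: For a graph $G$ and $X\subseteq V(G)$, $N(X)$ denotes the set of vertices adjacent to some vertex of $X$ (open neighborhood) and $N[X]=X\cup N(X)$ (closed neighborhood); $G[X]$ is the subgraph induced by $X$. A set $S\subseteq V(G)$ is independent if no two of its vertices are adjacent. A set $S\subseteq V(G)$ is a local maximum independent set of $G$ if $S$ is a maximum independent set of the induced subgraph $G[N[S]]$; $\Psi(G)$ denotes the family of all local maximum independent sets of $G$. A pair $(E,\mathcal F)$ with nonempty $\mathcal F\subseteq 2^E$ is an augmentoid if for every $X,Y\in\mathcal F$ there exist $A\subseteq X\setminus Y$ and $B\subseteq Y\setminus X$ with $Y\cup A\in\mathcal F$, $X\cup B\in\mathcal F$, and $|Y\cup A|=|X\cup B|$. -}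

module Defs where

open import Data.Nat using (ℕ; _≤_)
open import Data.Bool using (Bool; true; false)
open import Data.Fin using (Fin)
open import Data.Fin.Subset using (Subset; _∈_; _⊆_; _∪_; ∣_∣)
open import Data.Product using (Σ; ∃; _×_; _,_)
open import Relation.Binary.PropositionalEquality using (_≡_)

record Graph (n : ℕ) : Set where
  field
    adj   : Fin n → Fin n → Bool
    sym   : ∀ u v → adj u v ≡ adj v u
    irrefl : ∀ v → adj v v ≡ false
open Graph public

module _ {n : ℕ} (G : Graph n) where

  Adj : Fin n → Fin n → Set
  Adj u v = adj G u v ≡ true

  Independent : Subset n → Set
  Independent S = ∀ u v → u ∈ S → v ∈ S → ¬Adj u v
    where
      ¬Adj : Fin n → Fin n → Set
      ¬Adj u v = adj G u v ≡ false

  InN : Subset n → Fin n → Set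
  InN X v = ∃ λ u → u ∈ X × Adj u v

  InN[] : Subset n → Fin n → Set
  InN[] X v = v ∈ X Data.Sum.⊎ InN X v
    where import Data.Sum

  MaxIndepIn : (Fin n → Set) → Subset n → Set
  MaxIndepIn W S =
    (∀ v → v ∈ S → W v) × Independent S ×
    (∀ (T : Subset n) → (∀ v → v ∈ T → W v) → Independent T → ∣ T ∣ ≤ ∣ S ∣)

  -- S ∈ Ψ(G): S is a maximum independent set of G[N[S]]
  LocalMaxIndep : Subset n → Set
  LocalMaxIndep S = MaxIndepIn (InN[] S) S

IsAugmentoid : {n : ℕ} → (Subset n → Set) → Set
IsAugmentoid {n} F =
  (∃ λ X → F X) ×
  (∀ X Y → F X → F Y →
     Σ (Subset n) λ A → Σ (Subset n) λ B →
       (A ⊆ Data.Fin.Subset._─_ X Y) × (B ⊆ Data.Fin.Subset._─_ Y X) ×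
       F (Y ∪ A) × F (X ∪ B) × (∣ Y ∪ A ∣ ≡ ∣ X ∪ B ∣))
  where import Data.Fin.Subset

{-# OPTIONS --safe #-}
-- If S is independent and T ∈ Ψ(G), then for every independent I with I ─ N[S] ⊆ N[T]
-- the set (S ∩ N[T]) ∪ (I ─ N[S]) is an independent subset of N[T], so
-- |S ∩ N[T]| + |I ─ N[S]| ≤ |T|. For I = T this gives |S ∩ N[T]| ≤ |T ∩ N[S]|, hence
-- equality when S, T ∈ Ψ(G); applied to the independent subsets I of N[S ∪ (T ─ N[S])]
-- it shows S ∪ (T ─ N[S]) ∈ Ψ(G). With A = S ─ N[T] and B = T ─ N[S], both augmented
-- sets have size |S ∩ N[T]| + |S ─ N[T]| + |T ─ N[S]|.
module Submission where

open import Defs hiding (sym)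
open import Data.Nat using (ℕ; suc; _+_; _≤_)
open import Data.Nat.Properties
  using (+-suc; +-cancelˡ-≤; +-cancelʳ-≤; +-mono-≤; ≤-antisym; +-commutativeSemigroup; module ≤-Reasoning)
open import Algebra.Properties.CommutativeSemigroup +-commutativeSemigroup using (xy∙z≈xz∙y)
open import Data.Bool using (true; false; _≟_)
open import Data.Bool.Properties using (T-≡; ¬-not)
open import Data.Fin using (Fin)
open import Data.Fin.Subset
open import Data.Fin.Subset.Properties
open import Data.Fin.Properties using (any?)
open import Data.Vec using (_∷_; []; here; there; tabulate)
open import Data.Vec.Properties using (lookup∘tabulate; lookup⇒[]=; []=⇒lookup)
open import Data.Product using (_,_; proj₁; proj₂)
open import Data.Sum using (_⊎_; inj₁; inj₂)
import Data.Sum as ⊎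
open import Function using (_∘_; flip)
open import Function.Bundles using (Equivalence)
open import Relation.Nullary using (Dec; contradiction)
open import Relation.Nullary.Decidable using (isYes; toWitness; fromWitness; _⊎-dec_; _×-dec_)
open import Relation.Binary.PropositionalEquality using (_≡_; refl; sym; trans; cong; module ≡-Reasoning)

module _ {n : ℕ} where

  fromDec : {P : Fin n → Set} → (∀ x → Dec (P x)) → Subset n
  fromDec P? = tabulate (λ x → isYes (P? x))

  module _ {P : Fin n → Set} {P? : ∀ x → Dec (P x)} {x : Fin n} where

    ∈fromDec⁺ : P x → x ∈ fromDec P?
    ∈fromDec⁺ px = lookup⇒[]= x _
      (trans (lookup∘tabulate _ x) (Equivalence.to T-≡ (fromWitness {a? = P? x} px)))

    ∈fromDec⁻ : x ∈ fromDec P? → P x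
    ∈fromDec⁻ x∈ = toWitness {a? = P? x}
      (Equivalence.from T-≡ (trans (sym (lookup∘tabulate _ x)) ([]=⇒lookup x∈)))

x∈p─q⇒x∉q : ∀ {n} {p q : Subset n} {x} → x ∈ p ─ q → x ∉ q
x∈p─q⇒x∉q {p = true ∷ _} {true ∷ _} () here
x∈p─q⇒x∉q {p = false ∷ _} {true ∷ _} () here
x∈p─q⇒x∉q {p = _ ∷ _} {_ ∷ _} (there x∈) (there x∈q) = x∈p─q⇒x∉q x∈ x∈q

─-monoʳ-⊆ : ∀ {n} {p q r : Subset n} → q ⊆ r → p ─ r ⊆ p ─ q
─-monoʳ-⊆ {p = p} {r = r} q⊆r x∈ = x∈p∧x∉q⇒x∈p─q (p─q⊆p p r x∈) (x∈p─q⇒x∉q x∈ ∘ q⊆r)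

∣p∣≡∣p∩q∣+∣p─q∣ : ∀ {n} (p q : Subset n) → ∣ p ∣ ≡ ∣ p ∩ q ∣ + ∣ p ─ q ∣
∣p∣≡∣p∩q∣+∣p─q∣ [] [] = refl
∣p∣≡∣p∩q∣+∣p─q∣ (true ∷ p) (true ∷ q) = cong suc (∣p∣≡∣p∩q∣+∣p─q∣ p q)
∣p∣≡∣p∩q∣+∣p─q∣ (true ∷ p) (false ∷ q) = trans (cong suc (∣p∣≡∣p∩q∣+∣p─q∣ p q)) (sym (+-suc _ _))
∣p∣≡∣p∩q∣+∣p─q∣ (false ∷ p) (true ∷ q) = ∣p∣≡∣p∩q∣+∣p─q∣ p q
∣p∣≡∣p∩q∣+∣p─q∣ (false ∷ p) (false ∷ q) = ∣p∣≡∣p∩q∣+∣p─q∣ p q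

∣p∪q∣≡∣p∣+∣q∣ : ∀ {n} (p q : Subset n) → (∀ {x} → x ∈ p → x ∉ q) → ∣ p ∪ q ∣ ≡ ∣ p ∣ + ∣ q ∣
∣p∪q∣≡∣p∣+∣q∣ [] [] _ = refl
∣p∪q∣≡∣p∣+∣q∣ (true ∷ p) (true ∷ q) disj = contradiction here (disj here)
∣p∪q∣≡∣p∣+∣q∣ (true ∷ p) (false ∷ q) disj = cong suc (∣p∪q∣≡∣p∣+∣q∣ p q (λ x∈p → disj (there x∈p) ∘ there))
∣p∪q∣≡∣p∣+∣q∣ (false ∷ p) (true ∷ q) disj =
  trans (cong suc (∣p∪q∣≡∣p∣+∣q∣ p q (λ x∈p x∈q → disj (there x∈p) (there x∈q)))) (sym (+-suc _ _))
∣p∪q∣≡∣p∣+∣q∣ (false ∷ p) (false ∷ q) disj = ∣p∪q∣≡∣p∣+∣q∣ p q (λ x∈p x∈q → disj (there x∈p) (there x∈q))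

module LocalMaxima {n : ℕ} (G : Graph n) where

  N[_] : Subset n → Subset n
  N[ S ] = fromDec InN[]?
    where
    InN[]? : ∀ v → Dec (InN[] G S v)
    InN[]? v = (v ∈? S) ⊎-dec any? (λ u → (u ∈? S) ×-dec (adj G u v ≟ true))

  module _ {S : Subset n} {v : Fin n} where

    ∈N[]⁺ : InN[] G S v → v ∈ N[ S ]
    ∈N[]⁺ = ∈fromDec⁺

    ∈N[]⁻ : v ∈ N[ S ] → InN[] G S v
    ∈N[]⁻ = ∈fromDec⁻

    adj⇒∈N[] : ∀ {u} → u ∈ S → Adj G u v → v ∈ N[ S ]
    adj⇒∈N[] u∈S uv = ∈N[]⁺ (inj₂ (_ , u∈S , uv))

  p⊆N[p] : ∀ {S} → S ⊆ N[ S ]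
  p⊆N[p] v∈S = ∈N[]⁺ (inj₁ v∈S)

  N[]-mono-⊆ : ∀ {p q} → p ⊆ q → N[ p ] ⊆ N[ q ]
  N[]-mono-⊆ p⊆q v∈ with ∈N[]⁻ v∈
  ... | inj₁ v∈p = p⊆N[p] (p⊆q v∈p)
  ... | inj₂ (_ , u∈p , uv) = adj⇒∈N[] (p⊆q u∈p) uv

  x∈N[p∪q]⁻ : ∀ {p q v} → v ∈ N[ p ∪ q ] → v ∈ N[ p ] ⊎ v ∈ N[ q ]
  x∈N[p∪q]⁻ {p} {q} v∈ with ∈N[]⁻ v∈
  ... | inj₁ v∈p∪q = ⊎.map p⊆N[p] p⊆N[p] (x∈p∪q⁻ p q v∈p∪q)
  ... | inj₂ (_ , u∈p∪q , uv) =
    ⊎.map (λ u∈p → adj⇒∈N[] u∈p uv) (λ u∈q → adj⇒∈N[] u∈q uv) (x∈p∪q⁻ p q u∈p∪q)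

  Independent-antimono : ∀ {I J} → J ⊆ I → Independent G I → Independent G J
  Independent-antimono J⊆I indI u v u∈J v∈J = indI u v (J⊆I u∈J) (J⊆I v∈J)

  augment : Subset n → Subset n → Subset n
  augment S X = S ∪ (X ─ N[ S ])

  ∣augment∣ : ∀ S X → ∣ augment S X ∣ ≡ ∣ S ∣ + ∣ X ─ N[ S ] ∣
  ∣augment∣ S X = ∣p∪q∣≡∣p∣+∣q∣ S (X ─ N[ S ]) (λ x∈S x∈ → x∈p─q⇒x∉q x∈ (p⊆N[p] x∈S))

  augment-independent : ∀ {S X} → Independent G S → Independent G X → Independent G (augment S X)
  augment-independent {S} {X} indS indX u v u∈ v∈ with x∈p∪q⁻ S _ u∈ | x∈p∪q⁻ S _ v∈
  ... | inj₁ u∈S | inj₁ v∈S = indS u v u∈S v∈S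
  ... | inj₂ u∈X | inj₂ v∈X = indX u v (p─q⊆p X N[ S ] u∈X) (p─q⊆p X N[ S ] v∈X)
  ... | inj₁ u∈S | inj₂ v∈X = ¬-not (x∈p─q⇒x∉q v∈X ∘ adj⇒∈N[] u∈S)
  ... | inj₂ u∈X | inj₁ v∈S = ¬-not (x∈p─q⇒x∉q u∈X ∘ adj⇒∈N[] v∈S ∘ trans (Graph.sym G v u))

  N[augment]─N[S]⊆N[T] : ∀ {S T v} → v ∈ N[ augment S T ] → v ∉ N[ S ] → v ∈ N[ T ]
  N[augment]─N[S]⊆N[T] {S} {T} v∈ v∉ with x∈N[p∪q]⁻ v∈
  ... | inj₁ v∈N[S] = contradiction v∈N[S] v∉
  ... | inj₂ v∈N[T─N[S]] = N[]-mono-⊆ (p─q⊆p T N[ S ]) v∈N[T─N[S]]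

  localMax-independent : ∀ {S} → LocalMaxIndep G S → Independent G S
  localMax-independent = proj₁ ∘ proj₂

  localMax-bound : ∀ {T I} → LocalMaxIndep G T → Independent G I → I ⊆ N[ T ] → ∣ I ∣ ≤ ∣ T ∣
  localMax-bound {I = I} (_ , _ , maxT) indI I⊆ = maxT I (λ _ v∈ → ∈N[]⁻ (I⊆ v∈)) indI

  localMax-intro : ∀ {S} → Independent G S →
                   (∀ I → Independent G I → I ⊆ N[ S ] → ∣ I ∣ ≤ ∣ S ∣) → LocalMaxIndep G S
  localMax-intro indS maxS = (λ _ → inj₁) , indS , λ I I⊆ indI → maxS I indI (∈N[]⁺ ∘ I⊆ _)

  ⊥-localMax : LocalMaxIndep G ⊥
  ⊥-localMax = localMax-intro (λ _ _ u∈⊥ → contradiction u∈⊥ ∉⊥)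
    (λ I _ I⊆ → p⊆q⇒∣p∣≤∣q∣ (N[⊥]⊆⊥ ∘ I⊆))
    where
    N[⊥]⊆⊥ : N[ ⊥ ] ⊆ ⊥
    N[⊥]⊆⊥ v∈ with ∈N[]⁻ v∈
    ... | inj₁ v∈⊥ = v∈⊥
    ... | inj₂ (_ , u∈⊥ , _) = contradiction u∈⊥ ∉⊥

  module _ {S T : Subset n} (indS : Independent G S) (maxT : LocalMaxIndep G T) where

    ∣S∩N[T]∣+∣I─N[S]∣≤∣T∣ : ∀ {I} → Independent G I → I ─ N[ S ] ⊆ N[ T ] →
                            ∣ S ∩ N[ T ] ∣ + ∣ I ─ N[ S ] ∣ ≤ ∣ T ∣
    ∣S∩N[T]∣+∣I─N[S]∣≤∣T∣ {I} indI I─N[S]⊆N[T] = begin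
      ∣ S ∩ N[ T ] ∣ + ∣ I ─ N[ S ] ∣   ≡⟨ sym (∣p∪q∣≡∣p∣+∣q∣ _ _ disjoint) ⟩
      ∣ J ∣                             ≤⟨ localMax-bound maxT indJ J⊆N[T] ⟩
      ∣ T ∣                             ∎
      where
      open ≤-Reasoning
      J : Subset n
      J = (S ∩ N[ T ]) ∪ (I ─ N[ S ])
      disjoint : ∀ {x} → x ∈ S ∩ N[ T ] → x ∉ I ─ N[ S ]
      disjoint x∈ = flip x∈p─q⇒x∉q (p⊆N[p] (p∩q⊆p S N[ T ] x∈))
      indJ : Independent G J
      indJ = Independent-antimono
        (x∈p∪q⁺ ∘ ⊎.map₁ (p∩q⊆p S N[ T ]) ∘ x∈p∪q⁻ _ _)
        (augment-independent indS indI)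
      J⊆N[T] : J ⊆ N[ T ]
      J⊆N[T] = ⊎.[ p∩q⊆q S N[ T ] , I─N[S]⊆N[T] ] ∘ x∈p∪q⁻ _ _

    ∣S∩N[T]∣≤∣T∩N[S]∣ : ∣ S ∩ N[ T ] ∣ ≤ ∣ T ∩ N[ S ] ∣
    ∣S∩N[T]∣≤∣T∩N[S]∣ = +-cancelʳ-≤ ∣ T ─ N[ S ] ∣ _ _ (begin
      ∣ S ∩ N[ T ] ∣ + ∣ T ─ N[ S ] ∣   ≤⟨ ∣S∩N[T]∣+∣I─N[S]∣≤∣T∣ T-independent (p⊆N[p] ∘ p─q⊆p T N[ S ]) ⟩
      ∣ T ∣                             ≡⟨ ∣p∣≡∣p∩q∣+∣p─q∣ T N[ S ] ⟩
      ∣ T ∩ N[ S ] ∣ + ∣ T ─ N[ S ] ∣   ∎)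
      where
      open ≤-Reasoning
      T-independent : Independent G T
      T-independent = localMax-independent maxT

  module _ {S T : Subset n} (maxS : LocalMaxIndep G S) (maxT : LocalMaxIndep G T) where

    ∣S∩N[T]∣≡∣T∩N[S]∣ : ∣ S ∩ N[ T ] ∣ ≡ ∣ T ∩ N[ S ] ∣
    ∣S∩N[T]∣≡∣T∩N[S]∣ = ≤-antisym (∣S∩N[T]∣≤∣T∩N[S]∣ (localMax-independent maxS) maxT)
                                  (∣S∩N[T]∣≤∣T∩N[S]∣ (localMax-independent maxT) maxS)

    ∣I─N[S]∣≤∣T─N[S]∣ : ∀ {I} → Independent G I → I ─ N[ S ] ⊆ N[ T ] →
                        ∣ I ─ N[ S ] ∣ ≤ ∣ T ─ N[ S ] ∣
    ∣I─N[S]∣≤∣T─N[S]∣ {I} indI I─N[S]⊆N[T] = +-cancelˡ-≤ ∣ S ∩ N[ T ] ∣ _ _ (begin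
      ∣ S ∩ N[ T ] ∣ + ∣ I ─ N[ S ] ∣   ≤⟨ ∣S∩N[T]∣+∣I─N[S]∣≤∣T∣ S-independent maxT indI I─N[S]⊆N[T] ⟩
      ∣ T ∣                             ≡⟨ ∣p∣≡∣p∩q∣+∣p─q∣ T N[ S ] ⟩
      ∣ T ∩ N[ S ] ∣ + ∣ T ─ N[ S ] ∣   ≡⟨ cong (_+ ∣ T ─ N[ S ] ∣) (sym ∣S∩N[T]∣≡∣T∩N[S]∣) ⟩
      ∣ S ∩ N[ T ] ∣ + ∣ T ─ N[ S ] ∣   ∎)
      where
      open ≤-Reasoning
      S-independent : Independent G S
      S-independent = localMax-independent maxS

    augment-localMax : LocalMaxIndep G (augment S T)
    augment-localMax = localMax-intro
      (augment-independent (localMax-independent maxS) (localMax-independent maxT)) bound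
      where
      open ≤-Reasoning
      bound : ∀ I → Independent G I → I ⊆ N[ augment S T ] → ∣ I ∣ ≤ ∣ augment S T ∣
      bound I indI I⊆ = begin
        ∣ I ∣                             ≡⟨ ∣p∣≡∣p∩q∣+∣p─q∣ I N[ S ] ⟩
        ∣ I ∩ N[ S ] ∣ + ∣ I ─ N[ S ] ∣   ≤⟨ +-mono-≤ near far ⟩
        ∣ S ∣ + ∣ T ─ N[ S ] ∣             ≡⟨ sym (∣augment∣ S T) ⟩
        ∣ augment S T ∣                   ∎
        where
        near : ∣ I ∩ N[ S ] ∣ ≤ ∣ S ∣
        near = localMax-bound maxS (Independent-antimono (p∩q⊆p I N[ S ]) indI) (p∩q⊆q I N[ S ])
        far : ∣ I ─ N[ S ] ∣ ≤ ∣ T ─ N[ S ] ∣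
        far = ∣I─N[S]∣≤∣T─N[S]∣ indI (λ v∈ →
          N[augment]─N[S]⊆N[T] (I⊆ (p─q⊆p I N[ S ] v∈)) (x∈p─q⇒x∉q v∈))

    ∣augment∣-comm : ∣ augment T S ∣ ≡ ∣ augment S T ∣
    ∣augment∣-comm = begin
      ∣ augment T S ∣                                      ≡⟨ ∣augment∣ T S ⟩
      ∣ T ∣ + ∣ S ─ N[ T ] ∣                               ≡⟨ cong (_+ ∣ S ─ N[ T ] ∣) (∣p∣≡∣p∩q∣+∣p─q∣ T N[ S ]) ⟩
      ∣ T ∩ N[ S ] ∣ + ∣ T ─ N[ S ] ∣ + ∣ S ─ N[ T ] ∣     ≡⟨ cong (λ k → k + ∣ T ─ N[ S ] ∣ + ∣ S ─ N[ T ] ∣) (sym ∣S∩N[T]∣≡∣T∩N[S]∣) ⟩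
      ∣ S ∩ N[ T ] ∣ + ∣ T ─ N[ S ] ∣ + ∣ S ─ N[ T ] ∣     ≡⟨ xy∙z≈xz∙y ∣ S ∩ N[ T ] ∣ _ _ ⟩
      ∣ S ∩ N[ T ] ∣ + ∣ S ─ N[ T ] ∣ + ∣ T ─ N[ S ] ∣     ≡⟨ cong (_+ ∣ T ─ N[ S ] ∣) (sym (∣p∣≡∣p∩q∣+∣p─q∣ S N[ T ])) ⟩
      ∣ S ∣ + ∣ T ─ N[ S ] ∣                               ≡⟨ sym (∣augment∣ S T) ⟩
      ∣ augment S T ∣                                      ∎
      where open ≡-Reasoning

theorem1p1 : (n : ℕ) (G : Graph n) → IsAugmentoid (LocalMaxIndep G)
theorem1p1 n G = (⊥ , ⊥-localMax) , λ S T maxS maxT →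
    S ─ N[ T ] , T ─ N[ S ]
  , ─-monoʳ-⊆ p⊆N[p] , ─-monoʳ-⊆ p⊆N[p]
  , augment-localMax maxT maxS , augment-localMax maxS maxT
  , ∣augment∣-comm maxS maxT
  where open LocalMaxima G
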